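{- Let $k\geq 6$ be an integer. Let $A=\{a_1,a_2,\ldots,a_k\}$ be a set of nonnegative integers such that $0=a_1<a_2<\cdots<a_k$. If $|4^{\wedge}_{\pm}A| = 8k-19$, then $A=a_2\ast[0,k-1]$.
   Context: For a finite set $A=\{a_1,\ldots,a_k\}$ of integers and a positive integer $h$, the restricted $h$-fold signed sumset is $h^{\wedge}_{\pm}A=\left\{\sum_{i=1}^{k}\lambda_i a_i : \lambda_i\in\{ -1,0,1\} \text{ for all } i,\ \sum_{i=1}^{k}|\lambda_i| = h\right\}$. For integers $a\le b$, $[a,b]=\{n\in\mathbb{Z}: a\le n\le b\}$; for an integer $c$ and a set $S$ of integers, $c\ast S=\{cs: s\in S\}$. -}

module Defs where

open import Data.Nat using (ℕ; zero; suc)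
open import Data.Integer using (ℤ; +_; -_; _+_)
import Data.Integer.Properties as ℤP
open import Data.List using (List; []; _∷_; _++_; map; deduplicate; length)
open import Data.Fin using (Fin)
open import Data.Vec.Functional using (toList)

-- signedSums h xs : list (with repetitions) of all sums Σ λᵢ xᵢ with
-- λᵢ ∈ {-1,0,1} and Σ |λᵢ| = h, over the list xs of elements.
signedSums : ℕ → List ℤ → List ℤ
signedSums zero    []       = + 0 ∷ []
signedSums (suc h) []       = []
signedSums zero    (x ∷ xs) = signedSums zero xs
signedSums (suc h) (x ∷ xs) =
  signedSums (suc h) xs
  ++ map (λ s → x + s) (signedSums h xs)
  ++ map (λ s → (- x) + s) (signedSums h xs)

restrictedSignedSumset : ∀ {k} → ℕ → (Fin k → ℤ) → List ℤ
restrictedSignedSumset h a = deduplicate ℤP._≟_ (signedSums h (toList a))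

card-hSignedSumset : ∀ {k} → ℕ → (Fin k → ℤ) → ℕ
card-hSignedSumset h a = length (restrictedSignedSumset h a)

-- Order A as b_{k−1} > ⋯ > b₁ = d > b₀ = 0. As 4^∧_± A = −4^∧_± A, it suffices to find
-- 4k − 9 distinct positive signed sums whenever A ≠ d ∗ [0, k − 1]: with their negatives
-- they give |4^∧_± A| ≥ 8k − 18. This goes by induction on k. If A ∖ {b_{k−1}} is not a
-- progression, the four sums of b_{k−1} with three of b_{k−2}, …, b_{k−5} exceed all sums
-- of the smaller set. If it is d ∗ [0, k − 2] but b_{k−1} ≠ (k − 1)d, five sums
-- b_{k−1} + (three further entries) are added to the multiples of d already present.
-- For k = 6, split on which gap b_{i+1} − b_i differs from d; in each branch
-- 15 sums are listed, their order checked by Farkas certificates over the order of the bᵢ.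

module Submission where

open import Defs
open import Data.Nat using (ℕ; zero; suc; _+_; _*_; _∸_; _≤_; _<_; _≤ᵇ_; _≡ᵇ_; z≤n; s≤s)
import Data.Nat.Properties as ℕP
open import Data.Nat.Tactic.RingSolver using (solve-∀)
open import Data.Integer using (ℤ; +_; -_) renaming (_+_ to _+ℤ_; _*_ to _*ℤ_)
import Data.Integer.Properties as ℤP
import Data.Integer.Tactic.RingSolver as ZRing
open import Algebra.Properties.CommutativeSemigroup ℤP.+-commutativeSemigroup using (x∙yz≈y∙xz)
open import Data.List using (List; []; _∷_; [_]; _++_; _∷ʳ_; map; deduplicate; length; applyDownFrom; downFrom)
open import Data.List.Properties
  using (≡-dec; ∷-injectiveˡ; ∷-injectiveʳ; length-map; length-++; length-removeAt′; length-applyDownFrom;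
         map-∘; map-cong; map-downFrom; map-tabulate)
open import Data.List.Membership.Propositional using (_∈_)
open import Data.List.Membership.Propositional.Properties using (∈-map⁺; ∈-map⁻; ∈-++⁺ˡ; ∈-++⁺ʳ; ∈-++⁻)
open import Data.List.Relation.Unary.Any using (here; there; index; _─_)
import Data.List.Relation.Unary.Any.Properties as Any
open import Data.List.Relation.Unary.All as All using (All; []; _∷_)
open import Data.List.Relation.Unary.AllPairs using ([]; _∷_)
open import Data.List.Relation.Unary.Unique.Propositional using (Unique)
import Data.List.Relation.Unary.Unique.Propositional.Properties as Unique
open import Data.List.Relation.Binary.Subset.Propositional using (_⊆_)
open import Data.List.Relation.Binary.Permutation.Propositional using (_↭_; refl; prep; swap; trans; ↭-reflexive)
open import Data.List.Relation.Binary.Permutation.Propositional.Properties using (∷↭∷ʳ) renaming (map⁺ to ↭-map⁺)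
open import Data.Fin as Fin using (Fin; toℕ; fromℕ; inject₁; lower₁)
import Data.Fin.Properties as FinP
open import Data.Vec.Functional using (toList)
open import Data.Product using (_×_; _,_; proj₁; proj₂; ∃)
open import Data.Sum using (inj₁; inj₂)
open import Data.Empty using (⊥; ⊥-elim)
open import Relation.Nullary using (yes; no)
open import Relation.Binary using (tri<; tri≈; tri>)
open import Data.Bool using (Bool; true; false; T; _∧_; if_then_else_)
open import Data.Bool.Properties using (T-∧)
open import Function.Bundles using (Equivalence; _⇔_; mk⇔)
open import Function using (_∘_)
open import Relation.Binary.PropositionalEquality as ≡ using (_≡_; _≢_; cong; cong₂; sym; subst; subst₂)

-- Restricted signed sums

variable
  h : ℕ
  s : ℤ
  x y : ℤ
  xs ys : List ℤ

data SignedSum : ℕ → List ℤ → ℤ → Set where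
  []    : SignedSum 0 [] (+ 0)
  skip  : SignedSum h xs s → SignedSum h (x ∷ xs) s
  plus  : SignedSum h xs s → SignedSum (suc h) (x ∷ xs) (x +ℤ s)
  minus : SignedSum h xs s → SignedSum (suc h) (x ∷ xs) (- x +ℤ s)

SignedSum⇒∈signedSums : SignedSum h xs s → s ∈ signedSums h xs
SignedSum⇒∈signedSums []                 = here ≡.refl
SignedSum⇒∈signedSums (skip {zero} p)    = SignedSum⇒∈signedSums p
SignedSum⇒∈signedSums (skip {suc h} p)   = ∈-++⁺ˡ (SignedSum⇒∈signedSums p)
SignedSum⇒∈signedSums (plus {h} {xs} {x = x} p) =
  ∈-++⁺ʳ (signedSums (suc h) xs) (∈-++⁺ˡ (∈-map⁺ (λ t → x +ℤ t) (SignedSum⇒∈signedSums p)))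
SignedSum⇒∈signedSums (minus {h} {xs} {x = x} p) =
  ∈-++⁺ʳ (signedSums (suc h) xs) (∈-++⁺ʳ (map (λ t → x +ℤ t) (signedSums h xs))
    (∈-map⁺ (λ t → - x +ℤ t) (SignedSum⇒∈signedSums p)))

SignedSum-zero : ∀ xs → SignedSum 0 xs (+ 0)
SignedSum-zero []       = []
SignedSum-zero (x ∷ xs) = skip (SignedSum-zero xs)

SignedSum-neg : SignedSum h xs s → SignedSum h xs (- s)
SignedSum-neg []        = []
SignedSum-neg (skip p)  = skip (SignedSum-neg p)
SignedSum-neg (plus {s = s} {x = x} p) =
  subst (SignedSum _ _) (sym (ℤP.neg-distrib-+ x s)) (minus (SignedSum-neg p))
SignedSum-neg (minus {s = s} {x = x} p) =
  subst (SignedSum _ _) eq (plus (SignedSum-neg p))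
  where
  eq : x +ℤ - s ≡ - (- x +ℤ s)
  eq = ≡.trans (cong (_+ℤ - s) (sym (ℤP.neg-involutive x))) (sym (ℤP.neg-distrib-+ (- x) s))

SignedSum-swap : SignedSum h (x ∷ y ∷ xs) s → SignedSum h (y ∷ x ∷ xs) s
SignedSum-swap (skip (skip p))   = skip (skip p)
SignedSum-swap (skip (plus p))   = plus (skip p)
SignedSum-swap (skip (minus p))  = minus (skip p)
SignedSum-swap (plus (skip p))   = skip (plus p)
SignedSum-swap (minus (skip p))  = skip (minus p)
SignedSum-swap (plus {x = x} (plus {s = s} {x = y} p)) =
  subst (SignedSum _ _) (x∙yz≈y∙xz y x s) (plus (plus p))
SignedSum-swap (plus {x = x} (minus {s = s} {x = y} p)) =
  subst (SignedSum _ _) (x∙yz≈y∙xz (- y) x s) (minus (plus p))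
SignedSum-swap (minus {x = x} (plus {s = s} {x = y} p)) =
  subst (SignedSum _ _) (x∙yz≈y∙xz y (- x) s) (plus (minus p))
SignedSum-swap (minus {x = x} (minus {s = s} {x = y} p)) =
  subst (SignedSum _ _) (x∙yz≈y∙xz (- y) (- x) s) (minus (minus p))

SignedSum-∷⁺ : (∀ {h s} → SignedSum h xs s → SignedSum h ys s) →
               SignedSum h (x ∷ xs) s → SignedSum h (x ∷ ys) s
SignedSum-∷⁺ f (skip p)  = skip (f p)
SignedSum-∷⁺ f (plus p)  = plus (f p)
SignedSum-∷⁺ f (minus p) = minus (f p)

SignedSum-resp-↭ : xs ↭ ys → SignedSum h xs s → SignedSum h ys s
SignedSum-resp-↭ refl          p = p
SignedSum-resp-↭ (prep x eq)   p = SignedSum-∷⁺ (SignedSum-resp-↭ eq) p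
SignedSum-resp-↭ (swap x y eq) p = SignedSum-∷⁺ (SignedSum-∷⁺ (SignedSum-resp-↭ eq)) (SignedSum-swap p)
SignedSum-resp-↭ (trans e f)   p = SignedSum-resp-↭ f (SignedSum-resp-↭ e p)

-- Counting distinct sums

module _ {A : Set} where

  ∈-─⁺ : ∀ {u v : A} {zs} (p : u ∈ zs) → v ∈ zs → u ≢ v → v ∈ (zs ─ p)
  ∈-─⁺ (here ≡.refl) (here ≡.refl) u≢v = ⊥-elim (u≢v ≡.refl)
  ∈-─⁺ (here ≡.refl) (there q)     _   = q
  ∈-─⁺ (there p)     (here ≡.refl) _   = here ≡.refl
  ∈-─⁺ (there p)     (there q)     u≢v = there (∈-─⁺ p q u≢v)

  Unique-⊆⇒length≤ : ∀ {us vs : List A} → Unique us → us ⊆ vs → length us ≤ length vs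
  Unique-⊆⇒length≤ {[]}     _            _      = z≤n
  Unique-⊆⇒length≤ {u ∷ us} {vs} (u∉us ∷ uniq) us⊆vs =
    subst (suc (length us) ≤_) (sym (length-removeAt′ vs (index u∈vs)))
      (s≤s (Unique-⊆⇒length≤ uniq (λ v∈us → ∈-─⁺ u∈vs (us⊆vs (there v∈us)) (All.lookup u∉us v∈us))))
    where u∈vs = us⊆vs (here ≡.refl)

data DescendingChain (P : ℕ → Set) : ℕ → List ℕ → Set where
  []   : ∀ {B} → DescendingChain P B []
  cons : ∀ {B n ns} → n < B → 0 < n → P n → DescendingChain P n ns → DescendingChain P B (n ∷ ns)

DescendingChain-map : ∀ {P Q : ℕ → Set} {B ns} → (∀ {n} → P n → Q n) →
                      DescendingChain P B ns → DescendingChain Q B ns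
DescendingChain-map f []                 = []
DescendingChain-map f (cons n<B 0<n p c) = cons n<B 0<n (f p) (DescendingChain-map f c)

module _ {P : ℕ → Set} where

  DescendingChain-< : ∀ {B ns} → DescendingChain P B ns → All (_< B) ns
  DescendingChain-< []                 = []
  DescendingChain-< (cons n<B _ _ c) = n<B ∷ All.map (λ m<n → ℕP.<-trans m<n n<B) (DescendingChain-< c)

  DescendingChain-Unique : ∀ {B ns} → DescendingChain P B ns → Unique ns
  DescendingChain-Unique []               = []
  DescendingChain-Unique (cons _ _ _ c) =
    All.map (λ m<n n≡m → ℕP.<-irrefl (sym n≡m) m<n) (DescendingChain-< c) ∷ DescendingChain-Unique c

  ∈-DescendingChain : ∀ {B ns n} → n ∈ ns → DescendingChain P B ns → 0 < n × P n
  ∈-DescendingChain (here ≡.refl) (cons _ 0<n p _) = 0<n , p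
  ∈-DescendingChain (there n∈ns)  (cons _ _ _ c)   = ∈-DescendingChain n∈ns c

-- Each chain element n contributes the two distinct sums +n and -n.
DescendingChain⇒card : ∀ {B ns} → DescendingChain (λ n → SignedSum h xs (+ n)) B ns →
  length ns + length ns ≤ length (deduplicate ℤP._≟_ (signedSums h xs))
DescendingChain⇒card {h} {xs} {ns = ns} c =
  subst (_≤ _) (≡.trans (length-++ (map +_ ns)) (≡.cong₂ _+_ (length-map +_ ns) (length-map -ℕ ns)))
    (Unique-⊆⇒length≤ unique sums⊆)
  where
  -ℕ : ℕ → ℤ
  -ℕ n = - (+ n)
  sums = map +_ ns ++ map -ℕ ns
  unique : Unique sums
  unique = Unique.++⁺ (Unique.map⁺ ℤP.+-injective (DescendingChain-Unique c))
                      (Unique.map⁺ (ℤP.+-injective ∘ ℤP.neg-injective) (DescendingChain-Unique c))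
                      disjoint
    where
    disjoint : ∀ {v} → v ∈ map +_ ns × v ∈ map -ℕ ns → ⊥
    disjoint (p , q) with ∈-map⁻ +_ p | ∈-map⁻ -ℕ q
    ... | m , m∈ , ≡.refl | n , n∈ , +m≡-n
      with ∈-DescendingChain m∈ c | ∈-DescendingChain n∈ c
    ... | s≤s _ , _ | s≤s _ , _ with () ← +m≡-n
  sums⊆ : sums ⊆ deduplicate ℤP._≟_ (signedSums h xs)
  sums⊆ v∈sums = Any.deduplicate⁺ ℤP._≟_ (λ { ≡.refl q → q }) (SignedSum⇒∈signedSums (sum v∈sums))
    where
    sum : ∀ {v} → v ∈ sums → SignedSum h xs v
    sum v∈ with ∈-++⁻ (map +_ ns) v∈
    ... | inj₁ p with n , n∈ , ≡.refl ← ∈-map⁻ +_ p = proj₂ (∈-DescendingChain n∈ c)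
    ... | inj₂ q with n , n∈ , ≡.refl ← ∈-map⁻ -ℕ q = SignedSum-neg (proj₂ (∈-DescendingChain n∈ c))

-- Sign patterns

data Coeff : Set where
  Z P N : Coeff

Pattern : Set
Pattern = List Coeff

posPart : Pattern → List ℕ → ℕ
posPart (P ∷ p) (x ∷ X) = x + posPart p X
posPart (_ ∷ p) (x ∷ X) = posPart p X
posPart _       _       = 0

negPart : Pattern → List ℕ → ℕ
negPart (N ∷ p) (x ∷ X) = x + negPart p X
negPart (_ ∷ p) (x ∷ X) = negPart p X
negPart _       _       = 0

weight : Pattern → List ℕ → ℕ
weight (Z ∷ p) (x ∷ X) = weight p X
weight (_ ∷ p) (x ∷ X) = suc (weight p X)
weight _       _       = 0

-- Truncated subtraction: only meaningful when negPart p X ≤ posPart p X.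
value : Pattern → List ℕ → ℕ
value p X = posPart p X ∸ negPart p X

InSumset : ℕ → List ℕ → ℕ → Set
InSumset h X n = SignedSum h (map +_ X) (+ n)

SignedSum-pattern : ∀ p X → SignedSum (weight p X) (map +_ X) (+ posPart p X +ℤ - + negPart p X)
SignedSum-pattern (P ∷ p) (x ∷ X) =
  subst (SignedSum _ _) (sym (ℤP.+-assoc (+ x) (+ posPart p X) (- + negPart p X))) (plus (SignedSum-pattern p X))
SignedSum-pattern (N ∷ p) (x ∷ X) =
  subst (SignedSum _ _) (rearrange (+ x) (+ posPart p X) (+ negPart p X)) (minus (SignedSum-pattern p X))
  where
  rearrange : ∀ a b c → - a +ℤ (b +ℤ - c) ≡ b +ℤ - (a +ℤ c)
  rearrange = ZRing.solve-∀
SignedSum-pattern (Z ∷ p) (x ∷ X) = skip (SignedSum-pattern p X)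
SignedSum-pattern []      X       = SignedSum-zero (map +_ X)
SignedSum-pattern (P ∷ p) []      = []
SignedSum-pattern (N ∷ p) []      = []
SignedSum-pattern (Z ∷ p) []      = []

InSumset-value : ∀ p X → weight p X ≡ h → negPart p X ≤ posPart p X → InSumset h X (value p X)
InSumset-value p X ≡.refl n≤p =
  subst (SignedSum _ _) (≡.trans (ℤP.m-n≡m⊖n (posPart p X) (negPart p X)) (ℤP.⊖-≥ n≤p))
    (SignedSum-pattern p X)

InSumset-pattern : ∀ p X {m} → weight p X ≡ h → posPart p X ≡ m + negPart p X → InSumset h X m
InSumset-pattern p X {m} w eq =
  subst (InSumset _ X) value≡m (InSumset-value p X w (subst (negPart p X ≤_) (sym eq) (ℕP.m≤n+m (negPart p X) m)))
  where
  value≡m : value p X ≡ m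
  value≡m = ≡.trans (cong (_∸ negPart p X) eq) (ℕP.m+n∸n≡m m (negPart p X))

-- Linear forms and Farkas certificates

infixl 7 _·_ _*ᵛ_
infixl 6 _⊕_
infix  4 _≤ᵛ_

_·_ : List ℕ → List ℕ → ℕ
(c ∷ cs) · (x ∷ X) = c * x + cs · X
_        · _       = 0

_⊕_ : List ℕ → List ℕ → List ℕ
(a ∷ u) ⊕ (b ∷ v) = a + b ∷ u ⊕ v
[]      ⊕ v       = v
u       ⊕ []      = u

_*ᵛ_ : ℕ → List ℕ → List ℕ
c *ᵛ u = map (c *_) u

-- Coefficientwise comparison, reading a missing entry as 0.
_≤ᵛ_ : List ℕ → List ℕ → Bool
(a ∷ u) ≤ᵛ (b ∷ v) = (a ≤ᵇ b) ∧ (u ≤ᵛ v)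
(a ∷ u) ≤ᵛ []      = (a ≤ᵇ 0) ∧ (u ≤ᵛ [])
[]      ≤ᵛ _       = true

·-⊕ : ∀ u v X → (u ⊕ v) · X ≡ u · X + v · X
·-⊕ (a ∷ u) (b ∷ v) (x ∷ X) =
  ≡.trans (cong (λ t → (a + b) * x + t) (·-⊕ u v X)) (distrib-interchange a b x (u · X) (v · X))
  where
  distrib-interchange : ∀ a b x U V → (a + b) * x + (U + V) ≡ (a * x + U) + (b * x + V)
  distrib-interchange = solve-∀
·-⊕ (a ∷ u) (b ∷ v) []      = ≡.refl
·-⊕ []      v       X       = ≡.refl
·-⊕ (a ∷ u) []      X       = sym (ℕP.+-identityʳ _)

·-*ᵛ : ∀ c u X → (c *ᵛ u) · X ≡ c * (u · X)
·-*ᵛ c (a ∷ u) (x ∷ X) = ≡.trans (cong₂ _+_ (ℕP.*-assoc c a x) (·-*ᵛ c u X))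
                                  (sym (ℕP.*-distribˡ-+ c (a * x) (u · X)))
·-*ᵛ c (a ∷ u) []      = sym (ℕP.*-zeroʳ c)
·-*ᵛ c []      X       = sym (ℕP.*-zeroʳ c)

≤ᵛ⇒·-≤ : ∀ u v X → T (u ≤ᵛ v) → u · X ≤ v · X
≤ᵛ⇒·-≤ (a ∷ u) (b ∷ v) (x ∷ X) t with t₁ , t₂ ← Equivalence.to T-∧ t =
  ℕP.+-mono-≤ (ℕP.*-monoˡ-≤ x (ℕP.≤ᵇ⇒≤ a b t₁)) (≤ᵛ⇒·-≤ u v X t₂)
≤ᵛ⇒·-≤ (a ∷ u) []      (x ∷ X) t with t₁ , t₂ ← Equivalence.to T-∧ t =
  ℕP.+-mono-≤ (ℕP.*-monoˡ-≤ x (ℕP.≤ᵇ⇒≤ a 0 t₁)) (≤ᵛ⇒·-≤ u [] X t₂)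
≤ᵛ⇒·-≤ (a ∷ u) v       []      t = z≤n
≤ᵛ⇒·-≤ []      v       X       t = z≤n

posVec : Pattern → List ℕ
posVec = map λ { P → 1 ; _ → 0 }

negVec : Pattern → List ℕ
negVec = map λ { N → 1 ; _ → 0 }

posPart-· : ∀ p X → posPart p X ≡ posVec p · X
posPart-· (P ∷ p) (x ∷ X) = cong₂ _+_ (sym (ℕP.+-identityʳ x)) (posPart-· p X)
posPart-· (Z ∷ p) (x ∷ X) = posPart-· p X
posPart-· (N ∷ p) (x ∷ X) = posPart-· p X
posPart-· []      X       = ≡.refl
posPart-· (P ∷ p) []      = ≡.refl
posPart-· (Z ∷ p) []      = ≡.refl
posPart-· (N ∷ p) []      = ≡.refl

negPart-· : ∀ p X → negPart p X ≡ negVec p · X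
negPart-· (N ∷ p) (x ∷ X) = cong₂ _+_ (sym (ℕP.+-identityʳ x)) (negPart-· p X)
negPart-· (Z ∷ p) (x ∷ X) = negPart-· p X
negPart-· (P ∷ p) (x ∷ X) = negPart-· p X
negPart-· []      X       = ≡.refl
negPart-· (P ∷ p) []      = ≡.refl
negPart-· (Z ∷ p) []      = ≡.refl
negPart-· (N ∷ p) []      = ≡.refl

Cmp : Bool → ℕ → ℕ → Set
Cmp true  = _<_
Cmp false = _≤_

record LinearFact (X : List ℕ) : Set where
  constructor fact
  field
    lhs rhs : List ℕ
    strict  : Bool
    holds   : Cmp strict (lhs · X) (rhs · X)
open LinearFact

module _ {X : List ℕ} where

  lhsSum rhsSum : List (LinearFact X) → List ℕ → List ℕ
  lhsSum (f ∷ F) (l ∷ ls) = l *ᵛ lhs f ⊕ lhsSum F ls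
  lhsSum _       _        = []
  rhsSum (f ∷ F) (l ∷ ls) = l *ᵛ rhs f ⊕ rhsSum F ls
  rhsSum _       _        = []

  strictWeight : List (LinearFact X) → List ℕ → ℕ
  strictWeight (f ∷ F) (l ∷ ls) = (if strict f then l else 0) + strictWeight F ls
  strictWeight _       _        = 0

  scale-fact : ∀ f l → l * (lhs f · X) + (if strict f then l else 0) ≤ l * (rhs f · X)
  scale-fact (fact u v true  u<v) l =
    subst (_≤ l * (v · X)) (≡.trans (ℕP.*-suc l (u · X)) (ℕP.+-comm l _)) (ℕP.*-monoʳ-≤ l u<v)
  scale-fact (fact u v false u≤v) l =
    subst (_≤ l * (v · X)) (sym (ℕP.+-identityʳ _)) (ℕP.*-monoʳ-≤ l u≤v)

  combine : ∀ F ls → lhsSum F ls · X + strictWeight F ls ≤ rhsSum F ls · X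
  combine (f ∷ F) (l ∷ ls) =
    subst₂ _≤_ (sym lhs≡) (sym (·-scaled-⊕ (rhs f) (rhsSum F ls)))
      (ℕP.+-mono-≤ (scale-fact f l) (combine F ls))
    where
    ·-scaled-⊕ : ∀ u v → (l *ᵛ u ⊕ v) · X ≡ l * (u · X) + v · X
    ·-scaled-⊕ u v = ≡.trans (·-⊕ (l *ᵛ u) v X) (cong (_+ v · X) (·-*ᵛ l u X))
    interchange : ∀ a b c d → a + b + (c + d) ≡ a + c + (b + d)
    interchange = solve-∀
    lhs≡ : lhsSum (f ∷ F) (l ∷ ls) · X + strictWeight (f ∷ F) (l ∷ ls)
         ≡ (l * (lhs f · X) + (if strict f then l else 0)) + (lhsSum F ls · X + strictWeight F ls)
    lhs≡ = ≡.trans (cong (_+ strictWeight (f ∷ F) (l ∷ ls)) (·-scaled-⊕ (lhs f) (lhsSum F ls)))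
                   (interchange (l * (lhs f · X)) (lhsSum F ls · X) _ (strictWeight F ls))
  combine (f ∷ F) [] = z≤n
  combine []      ls = z≤n

  -- A Farkas certificate for B · X < A · X: multipliers ls for the facts F such that
  -- B + Σ lᵢ rhsᵢ ≤ A + Σ lᵢ lhsᵢ coefficientwise, with a strict fact of positive weight.
  Certifies : List ℕ → List ℕ → List (LinearFact X) → List ℕ → Bool
  Certifies A B F ls = (B ⊕ rhsSum F ls ≤ᵛ A ⊕ lhsSum F ls) ∧ (1 ≤ᵇ strictWeight F ls)

  Certifies⇒< : ∀ A B F ls → T (Certifies A B F ls) → B · X < A · X
  Certifies⇒< A B F ls t with t₁ , t₂ ← Equivalence.to T-∧ t =
    ℕP.+-cancelʳ-≤ L (suc (B · X)) (A · X) (begin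
      suc (B · X) + L                ≡⟨ shuffle (B · X) L ⟩
      (L + 1) + B · X                ≤⟨ ℕP.+-monoˡ-≤ (B · X) (ℕP.+-monoʳ-≤ L (ℕP.≤ᵇ⇒≤ 1 w t₂)) ⟩
      (L + w) + B · X                ≤⟨ ℕP.+-monoˡ-≤ (B · X) (combine F ls) ⟩
      R + B · X                      ≡⟨ ℕP.+-comm R (B · X) ⟩
      B · X + R                      ≡⟨ sym (·-⊕ B (rhsSum F ls) X) ⟩
      (B ⊕ rhsSum F ls) · X          ≤⟨ ≤ᵛ⇒·-≤ (B ⊕ rhsSum F ls) (A ⊕ lhsSum F ls) X t₁ ⟩
      (A ⊕ lhsSum F ls) · X          ≡⟨ ·-⊕ A (lhsSum F ls) X ⟩
      A · X + L                      ∎)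
    where
    open ℕP.≤-Reasoning
    L = lhsSum F ls · X
    R = rhsSum F ls · X
    w = strictWeight F ls
    shuffle : ∀ b l → suc b + l ≡ (l + 1) + b
    shuffle = solve-∀

∸-<-∸ : ∀ {a b c d} → d < c → c + b < a + d → b < a × c ∸ d < a ∸ b
∸-<-∸ {a} {b} {c} {d} d<c c+b<a+d = b<a , r<a∸b
  where
  r = c ∸ d
  r+b<a : r + b < a
  r+b<a = ℕP.+-cancelˡ-< d (r + b) a (subst₂ _<_
    (≡.trans (cong (_+ b) (sym (ℕP.m+[n∸m]≡n (ℕP.<⇒≤ d<c)))) (ℕP.+-assoc d r b))
    (ℕP.+-comm a d) c+b<a+d)
  b<a : b < a
  b<a = ℕP.≤-<-trans (ℕP.m≤n+m b r) r+b<a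
  r<a∸b : r < a ∸ b
  r<a∸b = subst (_≤ a ∸ b) (ℕP.m+n∸n≡m (suc r) b) (ℕP.∸-monoˡ-≤ b r+b<a)

infixr 5 _by_∷_

data CertifiedChain : Set where
  [_by_]  : Pattern → List ℕ → CertifiedChain
  _by_∷_  : Pattern → List ℕ → CertifiedChain → CertifiedChain

head : CertifiedChain → Pattern
head [ p by _ ]    = p
head (p by _ ∷ _) = p

values : CertifiedChain → List ℕ → List ℕ
values [ p by _ ]    X = value p X ∷ []
values (p by _ ∷ c) X = value p X ∷ values c X

chainLength : CertifiedChain → ℕ
chainLength [ _ by _ ]    = 1
chainLength (_ by _ ∷ c) = suc (chainLength c)

length-values : ∀ c X → length (values c X) ≡ chainLength c
length-values [ _ by _ ]    X = ≡.refl
length-values (_ by _ ∷ c) X = cong suc (length-values c X)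

-- The last certificate shows that the last value is positive, every other one that the next value is smaller.
Valid : ℕ → (X : List ℕ) → List (LinearFact X) → CertifiedChain → Bool
Valid h X F [ p by ls ] = (weight p X ≡ᵇ h) ∧ Certifies (posVec p) (negVec p) F ls
Valid h X F (p by ls ∷ c) =
  (weight p X ≡ᵇ h) ∧ (Certifies (posVec p ⊕ negVec (head c)) (posVec (head c) ⊕ negVec p) F ls ∧ Valid h X F c)

Valid⇒DescendingChain : ∀ X F c → T (Valid h X F c) →
  negPart (head c) X < posPart (head c) X ×
  (∀ {B} → value (head c) X < B → DescendingChain (InSumset h X) B (values c X))
Valid⇒DescendingChain X F [ p by ls ] t with w , cert ← Equivalence.to T-∧ t =
  n<p , λ v<B → cons v<B (ℕP.m<n⇒0<n∸m n<p) (InSumset-value p X (ℕP.≡ᵇ⇒≡ _ _ w) (ℕP.<⇒≤ n<p)) []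
  where
  n<p : negPart p X < posPart p X
  n<p = subst₂ _<_ (sym (negPart-· p X)) (sym (posPart-· p X)) (Certifies⇒< (posVec p) (negVec p) F ls cert)
Valid⇒DescendingChain X F (p by ls ∷ c) t
  with w , t′ ← Equivalence.to T-∧ t
  with cert , rest ← Equivalence.to T-∧ t′
  with n<pᶜ , chain ← Valid⇒DescendingChain X F c rest =
  n<p , λ v<B → cons v<B (ℕP.m<n⇒0<n∸m n<p) (InSumset-value p X (ℕP.≡ᵇ⇒≡ _ _ w) (ℕP.<⇒≤ n<p)) (chain vᶜ<v)
  where
  q = head c
  step : posPart q X + negPart p X < posPart p X + negPart q X
  step = subst₂ _<_
    (≡.trans (·-⊕ (posVec q) (negVec p) X) (sym (cong₂ _+_ (posPart-· q X) (negPart-· p X))))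
    (≡.trans (·-⊕ (posVec p) (negVec q) X) (sym (cong₂ _+_ (posPart-· p X) (negPart-· q X))))
    (Certifies⇒< (posVec p ⊕ negVec q) (posVec q ⊕ negVec p) F ls cert)
  n<p : negPart p X < posPart p X
  n<p = proj₁ (∸-<-∸ n<pᶜ step)
  vᶜ<v : value q X < value p X
  vᶜ<v = proj₂ (∸-<-∸ n<pᶜ step)

-- Arithmetic progressions

SignedSum-*ʳ : ∀ c → SignedSum h xs s → SignedSum h (map (_*ℤ c) xs) (s *ℤ c)
SignedSum-*ʳ c []        = []
SignedSum-*ʳ c (skip p)  = skip (SignedSum-*ʳ c p)
SignedSum-*ʳ c (plus {s = s} {x = x} p) =
  subst (SignedSum _ _) (sym (ℤP.*-distribʳ-+ c x s)) (plus (SignedSum-*ʳ c p))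
SignedSum-*ʳ c (minus {s = s} {x = x} p) =
  subst (SignedSum _ _) (≡.trans (cong (_+ℤ s *ℤ c) (ℤP.neg-distribˡ-* x c)) (sym (ℤP.*-distribʳ-+ c (- x) s)))
    (minus (SignedSum-*ʳ c p))

InSumset-*ʳ : ∀ d {X n} → InSumset h X n → InSumset h (map (_* d) X) (n * d)
InSumset-*ʳ d {X} {n} p = subst₂ (SignedSum _) map-pos (sym (ℤP.pos-* n d)) (SignedSum-*ʳ (+ d) p)
  where
  map-pos : map (_*ℤ + d) (map +_ X) ≡ map +_ (map (_* d) X)
  map-pos = ≡.trans (sym (map-∘ X)) (≡.trans (map-cong (λ x → sym (ℤP.pos-* x d)) X) (map-∘ X))

apList : ℕ → ℕ → List ℕ
apList d = applyDownFrom (_* d)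

downFrom-InSumset : ∀ n {j} → 1 ≤ j → j ≤ 10 + n * 4 → InSumset 4 (downFrom (5 + n)) j
downFrom-InSumset zero {1}  _ _ = InSumset-pattern (N ∷ P ∷ P ∷ Z ∷ P ∷ []) (downFrom 5) ≡.refl ≡.refl
downFrom-InSumset zero {2}  _ _ = InSumset-pattern (P ∷ N ∷ Z ∷ P ∷ P ∷ []) (downFrom 5) ≡.refl ≡.refl
downFrom-InSumset zero {3}  _ _ = InSumset-pattern (P ∷ Z ∷ N ∷ P ∷ P ∷ []) (downFrom 5) ≡.refl ≡.refl
downFrom-InSumset zero {4}  _ _ = InSumset-pattern (P ∷ P ∷ N ∷ N ∷ []) (downFrom 5) ≡.refl ≡.refl
downFrom-InSumset zero {5}  _ _ = InSumset-pattern (P ∷ Z ∷ P ∷ N ∷ P ∷ []) (downFrom 5) ≡.refl ≡.refl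
downFrom-InSumset zero {6}  _ _ = InSumset-pattern (P ∷ P ∷ Z ∷ N ∷ P ∷ []) (downFrom 5) ≡.refl ≡.refl
downFrom-InSumset zero {7}  _ _ = InSumset-pattern (P ∷ Z ∷ P ∷ P ∷ P ∷ []) (downFrom 5) ≡.refl ≡.refl
downFrom-InSumset zero {8}  _ _ = InSumset-pattern (P ∷ P ∷ Z ∷ P ∷ P ∷ []) (downFrom 5) ≡.refl ≡.refl
downFrom-InSumset zero {9}  _ _ = InSumset-pattern (P ∷ P ∷ P ∷ Z ∷ P ∷ []) (downFrom 5) ≡.refl ≡.refl
downFrom-InSumset zero {10} _ _ = InSumset-pattern (P ∷ P ∷ P ∷ P ∷ []) (downFrom 5) ≡.refl ≡.refl
downFrom-InSumset zero {suc (suc (suc (suc (suc (suc (suc (suc (suc (suc (suc _))))))))))}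
  _ (s≤s (s≤s (s≤s (s≤s (s≤s (s≤s (s≤s (s≤s (s≤s (s≤s ()))))))))))
downFrom-InSumset (suc n) {j} 1≤j j≤ with j ℕP.≤? 10 + n * 4
... | yes j≤′ = skip (downFrom-InSumset n 1≤j j≤′)
... | no  j≰  = subst (InSumset 4 X) (ℕP.m+[n∸m]≡n (ℕP.≰⇒> j≰)) (new (j ∸ (11 + n * 4)) t≤3)
  where
  X = downFrom (6 + n)
  t≤3 : j ∸ (11 + n * 4) ≤ 3
  t≤3 = subst (j ∸ (11 + n * 4) ≤_) (ℕP.m+n∸n≡m 3 (11 + n * 4)) (ℕP.∸-monoˡ-≤ (11 + n * 4) j≤)
  new : ∀ t → t ≤ 3 → InSumset 4 X (11 + n * 4 + t)
  new 0 _ = InSumset-pattern (P ∷ Z ∷ P ∷ P ∷ P ∷ []) X ≡.refl (eq n)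
    where eq : ∀ n → 5 + n + (3 + n + (2 + n + (1 + n + 0))) ≡ 11 + n * 4 + 0 + 0
          eq = solve-∀
  new 1 _ = InSumset-pattern (P ∷ P ∷ Z ∷ P ∷ P ∷ []) X ≡.refl (eq n)
    where eq : ∀ n → 5 + n + (4 + n + (2 + n + (1 + n + 0))) ≡ 11 + n * 4 + 1 + 0
          eq = solve-∀
  new 2 _ = InSumset-pattern (P ∷ P ∷ P ∷ Z ∷ P ∷ []) X ≡.refl (eq n)
    where eq : ∀ n → 5 + n + (4 + n + (3 + n + (1 + n + 0))) ≡ 11 + n * 4 + 2 + 0
          eq = solve-∀
  new 3 _ = InSumset-pattern (P ∷ P ∷ P ∷ P ∷ []) X ≡.refl (eq n)
    where eq : ∀ n → 5 + n + (4 + n + (3 + n + (2 + n + 0))) ≡ 11 + n * 4 + 3 + 0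
          eq = solve-∀
  new (suc (suc (suc (suc _)))) (s≤s (s≤s (s≤s ())))

apList-InSumset : ∀ d n {j} → 1 ≤ j → j ≤ 10 + n * 4 → InSumset 4 (apList d (5 + n)) (j * d)
apList-InSumset d n {j} 1≤j j≤ =
  subst (λ X → InSumset 4 X (j * d)) (map-downFrom (_* d) (5 + n)) (InSumset-*ʳ d (downFrom-InSumset n 1≤j j≤))

-- Chains of 4-fold signed sums

top : Pattern
top = P ∷ P ∷ P ∷ P ∷ []

record FourSumChain (ℓ : ℕ) (X : List ℕ) : Set where
  constructor chain
  field
    elements : List ℕ
    long     : ℓ ≤ length elements
    -- Quantifying over B lets larger sums be put in front of the chain.
    descends : ∀ {B} → value top X < B → DescendingChain (InSumset 4 X) B elements

data Decreasing (d : ℕ) : ℕ → List ℕ → Set where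
  [_,0] : 0 < d → Decreasing d 2 (d ∷ 0 ∷ [])
  _∷_   : ∀ {k x y D} → y < x → Decreasing d k (y ∷ D) → Decreasing d (suc k) (x ∷ y ∷ D)

Decreasing-pos : ∀ {d k D} → Decreasing d k D → 0 < d
Decreasing-pos [ 0<d ,0] = 0<d
Decreasing-pos (_ ∷ D)   = Decreasing-pos D

FourSumChain-∷ : ∀ {ℓ x y₁ y₂ y₃ y₄ D} → y₂ < y₁ → y₃ < y₂ → y₄ < y₃ → y₁ < x →
  FourSumChain ℓ (y₁ ∷ y₂ ∷ y₃ ∷ y₄ ∷ D) → FourSumChain (4 + ℓ) (x ∷ y₁ ∷ y₂ ∷ y₃ ∷ y₄ ∷ D)
FourSumChain-∷ {x = x} {y₁} {y₂} {y₃} {y₄} {D} y₂<y₁ y₃<y₂ y₄<y₃ y₁<x (chain c long descends) =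
  chain (value p₄ X ∷ value p₃ X ∷ value p₂ X ∷ value p₁ X ∷ c) (s≤s (s≤s (s≤s (s≤s long))))
    λ v₄<B → cons v₄<B positive (InSumset-value p₄ X ≡.refl z≤n)
           (cons v₃<v₄ positive (InSumset-value p₃ X ≡.refl z≤n)
           (cons v₂<v₃ positive (InSumset-value p₂ X ≡.refl z≤n)
           (cons v₁<v₂ positive (InSumset-value p₁ X ≡.refl z≤n)
           (DescendingChain-map skip (descends tail<v₁)))))
  where
  X = x ∷ y₁ ∷ y₂ ∷ y₃ ∷ y₄ ∷ D
  p₄ p₃ p₂ p₁ : Pattern
  p₄ = P ∷ P ∷ P ∷ P ∷ []
  p₃ = P ∷ P ∷ P ∷ Z ∷ P ∷ []
  p₂ = P ∷ P ∷ Z ∷ P ∷ P ∷ []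
  p₁ = P ∷ Z ∷ P ∷ P ∷ P ∷ []
  positive : ∀ {m} → 0 < x + m
  positive {m} = ℕP.<-≤-trans (ℕP.≤-<-trans z≤n y₁<x) (ℕP.m≤m+n x m)
  v₃<v₄ : value p₃ X < value p₄ X
  v₃<v₄ = ℕP.+-monoʳ-< x (ℕP.+-monoʳ-< y₁ (ℕP.+-monoʳ-< y₂ (ℕP.+-monoˡ-< 0 y₄<y₃)))
  v₂<v₃ : value p₂ X < value p₃ X
  v₂<v₃ = ℕP.+-monoʳ-< x (ℕP.+-monoʳ-< y₁ (ℕP.+-monoˡ-< (y₄ + 0) y₃<y₂))
  v₁<v₂ : value p₁ X < value p₂ X
  v₁<v₂ = ℕP.+-monoʳ-< x (ℕP.+-monoˡ-< (y₃ + (y₄ + 0)) y₂<y₁)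
  tail<v₁ : value top (y₁ ∷ y₂ ∷ y₃ ∷ y₄ ∷ D) < value p₁ X
  tail<v₁ = ℕP.+-monoˡ-< (y₂ + (y₃ + (y₄ + 0))) y₁<x

multiples : ℕ → ℕ → List ℕ
multiples d = applyDownFrom (λ i → suc i * d)

multiples-chain : ∀ {Q : ℕ → Set} {d B} j → 0 < d → (∀ {i} → 1 ≤ i → i ≤ j → Q (i * d)) →
                  j * d < B → DescendingChain Q B (multiples d j)
multiples-chain zero    0<d q jd<B = []
multiples-chain {d = d} (suc j) 0<d q jd<B =
  cons jd<B (ℕP.<-≤-trans 0<d (ℕP.m≤m+n d (j * d))) (q (s≤s z≤n) ℕP.≤-refl)
    (multiples-chain j 0<d (λ 1≤i i≤j → q 1≤i (ℕP.m≤n⇒m≤1+n i≤j)) (ℕP.+-monoˡ-< (j * d) 0<d))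

-- The five sums x + (i + 3n)d, 8 ≤ i ≤ 12, join the multiples jd, 1 ≤ j ≤ 14 + 4n, already present:
-- if x < (6 + n)d the multiple (14 + 4n)d falls between the two smallest of them, otherwise below all five.
module ExtendingAP {d n x : ℕ} (0<d : 0 < d) (x>₅ : (5 + n) * d < x) where

  X : List ℕ
  X = x ∷ apList d (6 + n)

  p₄ p₃ p₂ p₁ p₀ : Pattern
  p₄ = P ∷ P ∷ P ∷ P ∷ []
  p₃ = P ∷ P ∷ P ∷ Z ∷ P ∷ []
  p₂ = P ∷ P ∷ Z ∷ P ∷ P ∷ []
  p₁ = P ∷ Z ∷ P ∷ P ∷ P ∷ []
  p₀ = P ∷ P ∷ Z ∷ Z ∷ P ∷ P ∷ []

  three-terms : ∀ x a b c n d → x + ((a + n) * d + ((b + n) * d + ((c + n) * d + 0))) ≡ x + (a + b + c + n * 3) * d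
  three-terms = solve-∀
  split : ∀ a b n d → (a + n) * d + (b + n * 3) * d ≡ (a + b + n * 4) * d
  split = solve-∀

  positive : ∀ {m} → 0 < x + m
  positive {m} = ℕP.<-≤-trans (ℕP.≤-<-trans z≤n x>₅) (ℕP.m≤m+n x m)
  next : ∀ m → x + m * d < x + suc m * d
  next m = ℕP.+-monoʳ-< x (ℕP.+-monoˡ-< (m * d) 0<d)
  old : ∀ {i} → 1 ≤ i → i ≤ 14 + n * 4 → InSumset 4 X (i * d)
  old 1≤i i≤ = skip (apList-InSumset d (suc n) 1≤i i≤)

  v₄ : InSumset 4 X (value p₄ X)
  v₄ = InSumset-value p₄ X ≡.refl z≤n
  v₃ : InSumset 4 X (value p₃ X)
  v₃ = InSumset-value p₃ X ≡.refl z≤n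
  v₂ : InSumset 4 X (value p₂ X)
  v₂ = InSumset-value p₂ X ≡.refl z≤n
  v₁ : InSumset 4 X (value p₁ X)
  v₁ = InSumset-value p₁ X ≡.refl z≤n
  v₀ : InSumset 4 X (value p₀ X)
  v₀ = InSumset-value p₀ X ≡.refl z≤n

  v₃<v₄ : value p₃ X < value p₄ X
  v₃<v₄ = subst₂ _<_ (sym (three-terms x 5 4 2 n d)) (sym (three-terms x 5 4 3 n d)) (next (11 + n * 3))
  v₂<v₃ : value p₂ X < value p₃ X
  v₂<v₃ = subst₂ _<_ (sym (three-terms x 5 3 2 n d)) (sym (three-terms x 5 4 2 n d)) (next (10 + n * 3))
  v₁<v₂ : value p₁ X < value p₂ X
  v₁<v₂ = subst₂ _<_ (sym (three-terms x 4 3 2 n d)) (sym (three-terms x 5 3 2 n d)) (next (9 + n * 3))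
  v₀<v₁ : value p₀ X < value p₁ X
  v₀<v₁ = subst₂ _<_ (sym (three-terms x 5 2 1 n d)) (sym (three-terms x 4 3 2 n d)) (next (8 + n * 3))
  below-v₁ : (14 + n * 4) * d < value p₁ X
  below-v₁ = subst₂ _<_ (split 5 9 n d) (sym (three-terms x 4 3 2 n d)) (ℕP.+-monoˡ-< ((9 + n * 3) * d) x>₅)
  below-v₀ : ∀ {a} → (a + n) * d < x → (a + 8 + n * 4) * d < value p₀ X
  below-v₀ {a} x> = subst₂ _<_ (split a 8 n d) (sym (three-terms x 5 2 1 n d)) (ℕP.+-monoˡ-< ((8 + n * 3) * d) x>)
  above-v₀ : x < (6 + n) * d → value p₀ X < (14 + n * 4) * d
  above-v₀ x< = subst₂ _<_ (sym (three-terms x 5 2 1 n d)) (split 6 8 n d) (ℕP.+-monoˡ-< ((8 + n * 3) * d) x<)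

  below : x < (6 + n) * d → FourSumChain (19 + n * 4) X
  below x<₆ =
    chain (value p₄ X ∷ value p₃ X ∷ value p₂ X ∷ value p₁ X ∷ (14 + n * 4) * d ∷ value p₀ X ∷ multiples d (13 + n * 4))
      (ℕP.≤-reflexive (cong (λ m → 6 + m) (sym (length-applyDownFrom _ (13 + n * 4)))))
      λ v₄<B → cons v₄<B positive v₄ (cons v₃<v₄ positive v₃ (cons v₂<v₃ positive v₂ (cons v₁<v₂ positive v₁
             (cons below-v₁ (ℕP.<-≤-trans 0<d (ℕP.m≤m+n d _)) (old (s≤s z≤n) ℕP.≤-refl)
             (cons (above-v₀ x<₆) positive v₀
             (multiples-chain (13 + n * 4) 0<d (λ 1≤i i≤ → old 1≤i (ℕP.m≤n⇒m≤1+n i≤)) (below-v₀ {5} x>₅)))))))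

  above : (6 + n) * d < x → FourSumChain (19 + n * 4) X
  above x>₆ =
    chain (value p₄ X ∷ value p₃ X ∷ value p₂ X ∷ value p₁ X ∷ value p₀ X ∷ multiples d (14 + n * 4))
      (ℕP.≤-reflexive (cong (λ m → 5 + m) (sym (length-applyDownFrom _ (14 + n * 4)))))
      λ v₄<B → cons v₄<B positive v₄ (cons v₃<v₄ positive v₃ (cons v₂<v₃ positive v₂ (cons v₁<v₂ positive v₁
             (cons v₀<v₁ positive v₀ (multiples-chain (14 + n * 4) 0<d old (below-v₀ {6} x>₆))))))

AP-extension : ∀ {d n x} → 0 < d → (5 + n) * d < x → x ≢ (6 + n) * d →
               FourSumChain (19 + n * 4) (x ∷ apList d (6 + n))
AP-extension {d} {n} {x} 0<d x>₅ x≢₆ with ℕP.<-cmp x ((6 + n) * d)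
... | tri< x<₆ _ _ = ExtendingAP.below 0<d x>₅ x<₆
... | tri≈ _ x≡₆ _ = ⊥-elim (x≢₆ x≡₆)
... | tri> _ _ x>₆ = ExtendingAP.above 0<d x>₅ x>₆

-- Six elements

Valid⇒FourSumChain : ∀ X F c → T (Valid 4 X F c) → value (head c) X ≡ value top X →
                     FourSumChain (chainLength c) X
Valid⇒FourSumChain X F c valid head≡top =
  chain (values c X) (ℕP.≤-reflexive (sym (length-values c X)))
    λ {B} top<B → proj₂ (Valid⇒DescendingChain X F c valid) (subst (_< B) (sym head≡top) top<B)

gaps⇒apList : ∀ {b₆ b₅ b₄ b₃ d} → b₃ ≡ 2 * d → b₄ ≡ d + b₃ → b₅ ≡ d + b₄ → b₆ ≡ d + b₅ →
              b₆ ∷ b₅ ∷ b₄ ∷ b₃ ∷ d ∷ 0 ∷ [] ≡ apList d 6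
gaps⇒apList {d = d} ≡.refl ≡.refl ≡.refl ≡.refl =
  cong (λ t → 5 * d ∷ 4 * d ∷ 3 * d ∷ 2 * d ∷ t ∷ 0 ∷ []) (sym (ℕP.+-identityʳ d))

-- Descent certificates for the six-element case, one per way the gaps can first differ from d.
-- Coordinates are (b₆, b₅, b₄, b₃, d, 0); the multipliers refer to the fact lists of nonAP⇒FourSumChain₆.
b₄<b₃+d : CertifiedChain
b₄<b₃+d =
  (P ∷ P ∷ P ∷ P ∷ Z ∷ Z ∷ []) by (0 ∷ 0 ∷ 1 ∷ 0 ∷ 0 ∷ 0 ∷ 0 ∷ []) ∷
  (P ∷ P ∷ P ∷ Z ∷ P ∷ Z ∷ []) by (0 ∷ 0 ∷ 0 ∷ 1 ∷ 0 ∷ 0 ∷ 0 ∷ []) ∷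
  (P ∷ P ∷ Z ∷ P ∷ P ∷ Z ∷ []) by (0 ∷ 0 ∷ 0 ∷ 0 ∷ 0 ∷ 0 ∷ 1 ∷ []) ∷
  (P ∷ P ∷ P ∷ Z ∷ Z ∷ P ∷ []) by (0 ∷ 0 ∷ 0 ∷ 1 ∷ 0 ∷ 0 ∷ 0 ∷ []) ∷
  (P ∷ P ∷ Z ∷ P ∷ Z ∷ P ∷ []) by (0 ∷ 0 ∷ 0 ∷ 0 ∷ 0 ∷ 0 ∷ 1 ∷ []) ∷
  (P ∷ P ∷ P ∷ Z ∷ N ∷ Z ∷ []) by (0 ∷ 0 ∷ 1 ∷ 0 ∷ 0 ∷ 0 ∷ 0 ∷ []) ∷
  (P ∷ P ∷ P ∷ N ∷ Z ∷ Z ∷ []) by (0 ∷ 0 ∷ 0 ∷ 2 ∷ 0 ∷ 0 ∷ 0 ∷ []) ∷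
  (P ∷ P ∷ N ∷ P ∷ Z ∷ Z ∷ []) by (0 ∷ 0 ∷ 0 ∷ 0 ∷ 2 ∷ 0 ∷ 0 ∷ []) ∷
  (P ∷ N ∷ P ∷ P ∷ Z ∷ Z ∷ []) by (0 ∷ 0 ∷ 1 ∷ 0 ∷ 0 ∷ 0 ∷ 0 ∷ []) ∷
  (P ∷ N ∷ P ∷ Z ∷ P ∷ Z ∷ []) by (0 ∷ 0 ∷ 0 ∷ 1 ∷ 0 ∷ 0 ∷ 0 ∷ []) ∷
  (P ∷ N ∷ Z ∷ P ∷ P ∷ Z ∷ []) by (0 ∷ 0 ∷ 0 ∷ 0 ∷ 0 ∷ 0 ∷ 1 ∷ []) ∷
  (P ∷ N ∷ P ∷ Z ∷ Z ∷ P ∷ []) by (0 ∷ 0 ∷ 0 ∷ 1 ∷ 0 ∷ 0 ∷ 0 ∷ []) ∷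
  (P ∷ N ∷ Z ∷ P ∷ Z ∷ P ∷ []) by (0 ∷ 0 ∷ 0 ∷ 0 ∷ 0 ∷ 0 ∷ 1 ∷ []) ∷
  (P ∷ N ∷ P ∷ Z ∷ N ∷ Z ∷ []) by (0 ∷ 0 ∷ 1 ∷ 0 ∷ 0 ∷ 0 ∷ 0 ∷ []) ∷
  [ (P ∷ N ∷ P ∷ N ∷ Z ∷ Z ∷ []) by (0 ∷ 0 ∷ 0 ∷ 1 ∷ 0 ∷ 1 ∷ 0 ∷ []) ]

b₃<2d : CertifiedChain
b₃<2d =
  (P ∷ P ∷ P ∷ P ∷ Z ∷ Z ∷ []) by (0 ∷ 0 ∷ 1 ∷ 0 ∷ 0 ∷ 0 ∷ 0 ∷ 0 ∷ 0 ∷ []) ∷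
  (P ∷ P ∷ P ∷ Z ∷ P ∷ Z ∷ []) by (0 ∷ 0 ∷ 1 ∷ 0 ∷ 0 ∷ 0 ∷ 0 ∷ 0 ∷ 1 ∷ []) ∷
  (P ∷ P ∷ P ∷ Z ∷ Z ∷ P ∷ []) by (0 ∷ 0 ∷ 1 ∷ 0 ∷ 0 ∷ 0 ∷ 0 ∷ 0 ∷ 1 ∷ []) ∷
  (P ∷ P ∷ P ∷ Z ∷ N ∷ Z ∷ []) by (0 ∷ 0 ∷ 1 ∷ 0 ∷ 0 ∷ 0 ∷ 0 ∷ 0 ∷ 0 ∷ []) ∷
  (P ∷ P ∷ P ∷ N ∷ Z ∷ Z ∷ []) by (0 ∷ 0 ∷ 0 ∷ 0 ∷ 0 ∷ 0 ∷ 0 ∷ 1 ∷ 1 ∷ []) ∷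
  (P ∷ P ∷ Z ∷ P ∷ N ∷ Z ∷ []) by (0 ∷ 0 ∷ 0 ∷ 0 ∷ 1 ∷ 0 ∷ 0 ∷ 0 ∷ 0 ∷ []) ∷
  (P ∷ Z ∷ P ∷ P ∷ N ∷ Z ∷ []) by (2 ∷ 0 ∷ 1 ∷ 0 ∷ 0 ∷ 0 ∷ 0 ∷ 1 ∷ 0 ∷ []) ∷
  (P ∷ Z ∷ Z ∷ P ∷ P ∷ P ∷ []) by (0 ∷ 0 ∷ 1 ∷ 0 ∷ 0 ∷ 0 ∷ 1 ∷ 0 ∷ 0 ∷ []) ∷
  (P ∷ Z ∷ P ∷ N ∷ P ∷ Z ∷ []) by (0 ∷ 0 ∷ 0 ∷ 0 ∷ 0 ∷ 0 ∷ 0 ∷ 0 ∷ 1 ∷ []) ∷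
  (P ∷ Z ∷ P ∷ Z ∷ N ∷ P ∷ []) by (0 ∷ 0 ∷ 1 ∷ 0 ∷ 0 ∷ 0 ∷ 0 ∷ 0 ∷ 0 ∷ []) ∷
  (P ∷ Z ∷ P ∷ N ∷ Z ∷ P ∷ []) by (0 ∷ 0 ∷ 0 ∷ 0 ∷ 0 ∷ 0 ∷ 0 ∷ 1 ∷ 1 ∷ []) ∷
  (P ∷ Z ∷ Z ∷ P ∷ N ∷ P ∷ []) by (0 ∷ 0 ∷ 1 ∷ 0 ∷ 0 ∷ 0 ∷ 1 ∷ 0 ∷ 0 ∷ []) ∷
  (P ∷ Z ∷ P ∷ N ∷ N ∷ Z ∷ []) by (2 ∷ 0 ∷ 1 ∷ 0 ∷ 0 ∷ 0 ∷ 0 ∷ 1 ∷ 0 ∷ []) ∷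
  (P ∷ Z ∷ Z ∷ N ∷ P ∷ P ∷ []) by (0 ∷ 0 ∷ 0 ∷ 0 ∷ 0 ∷ 0 ∷ 0 ∷ 1 ∷ 1 ∷ []) ∷
  [ (P ∷ Z ∷ N ∷ P ∷ Z ∷ P ∷ []) by (0 ∷ 0 ∷ 2 ∷ 0 ∷ 1 ∷ 1 ∷ 0 ∷ 0 ∷ 1 ∷ []) ]

b₅<b₄+d : CertifiedChain
b₅<b₄+d =
  (P ∷ P ∷ P ∷ P ∷ Z ∷ Z ∷ []) by (0 ∷ 0 ∷ 0 ∷ 0 ∷ 1 ∷ 0 ∷ 0 ∷ 0 ∷ 0 ∷ 1 ∷ 1 ∷ []) ∷
  (P ∷ P ∷ P ∷ Z ∷ P ∷ Z ∷ []) by (0 ∷ 0 ∷ 0 ∷ 0 ∷ 1 ∷ 0 ∷ 0 ∷ 0 ∷ 0 ∷ 0 ∷ 1 ∷ []) ∷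
  (P ∷ P ∷ P ∷ Z ∷ Z ∷ P ∷ []) by (0 ∷ 0 ∷ 0 ∷ 0 ∷ 1 ∷ 0 ∷ 0 ∷ 1 ∷ 0 ∷ 0 ∷ 0 ∷ []) ∷
  (P ∷ Z ∷ P ∷ P ∷ P ∷ Z ∷ []) by (0 ∷ 0 ∷ 0 ∷ 0 ∷ 0 ∷ 0 ∷ 1 ∷ 0 ∷ 0 ∷ 0 ∷ 1 ∷ []) ∷
  (P ∷ P ∷ P ∷ Z ∷ N ∷ Z ∷ []) by (2 ∷ 0 ∷ 0 ∷ 0 ∷ 1 ∷ 0 ∷ 0 ∷ 1 ∷ 0 ∷ 0 ∷ 0 ∷ []) ∷
  (P ∷ Z ∷ P ∷ P ∷ Z ∷ P ∷ []) by (0 ∷ 0 ∷ 0 ∷ 0 ∷ 0 ∷ 0 ∷ 1 ∷ 0 ∷ 0 ∷ 1 ∷ 1 ∷ []) ∷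
  (P ∷ P ∷ P ∷ N ∷ Z ∷ Z ∷ []) by (0 ∷ 0 ∷ 0 ∷ 0 ∷ 1 ∷ 0 ∷ 0 ∷ 1 ∷ 1 ∷ 0 ∷ 0 ∷ []) ∷
  (P ∷ Z ∷ P ∷ P ∷ N ∷ Z ∷ []) by (2 ∷ 0 ∷ 0 ∷ 0 ∷ 1 ∷ 0 ∷ 0 ∷ 1 ∷ 0 ∷ 1 ∷ 1 ∷ []) ∷
  (P ∷ Z ∷ Z ∷ P ∷ P ∷ P ∷ []) by (0 ∷ 0 ∷ 0 ∷ 0 ∷ 0 ∷ 0 ∷ 0 ∷ 0 ∷ 0 ∷ 0 ∷ 1 ∷ []) ∷
  (P ∷ P ∷ N ∷ P ∷ Z ∷ Z ∷ []) by (0 ∷ 0 ∷ 0 ∷ 0 ∷ 1 ∷ 0 ∷ 1 ∷ 0 ∷ 0 ∷ 1 ∷ 0 ∷ []) ∷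
  (P ∷ Z ∷ P ∷ N ∷ P ∷ Z ∷ []) by (0 ∷ 0 ∷ 0 ∷ 0 ∷ 1 ∷ 0 ∷ 0 ∷ 1 ∷ 1 ∷ 0 ∷ 0 ∷ []) ∷
  (P ∷ N ∷ P ∷ P ∷ Z ∷ Z ∷ []) by (0 ∷ 0 ∷ 0 ∷ 0 ∷ 0 ∷ 0 ∷ 1 ∷ 0 ∷ 0 ∷ 1 ∷ 1 ∷ []) ∷
  (P ∷ Z ∷ P ∷ N ∷ Z ∷ P ∷ []) by (0 ∷ 0 ∷ 0 ∷ 0 ∷ 1 ∷ 0 ∷ 0 ∷ 1 ∷ 0 ∷ 0 ∷ 0 ∷ []) ∷
  (P ∷ N ∷ P ∷ Z ∷ P ∷ Z ∷ []) by (0 ∷ 0 ∷ 0 ∷ 0 ∷ 0 ∷ 0 ∷ 1 ∷ 0 ∷ 0 ∷ 0 ∷ 1 ∷ []) ∷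
  [ (P ∷ Z ∷ P ∷ N ∷ N ∷ Z ∷ []) by (0 ∷ 0 ∷ 0 ∷ 0 ∷ 4 ∷ 1 ∷ 0 ∷ 2 ∷ 0 ∷ 1 ∷ 3 ∷ []) ]

b₆<b₅+d : CertifiedChain
b₆<b₅+d =
  (P ∷ P ∷ P ∷ P ∷ Z ∷ Z ∷ []) by (0 ∷ 0 ∷ 0 ∷ 0 ∷ 0 ∷ 1 ∷ 0 ∷ 0 ∷ 0 ∷ 1 ∷ 0 ∷ 0 ∷ 1 ∷ []) ∷
  (P ∷ P ∷ P ∷ Z ∷ P ∷ Z ∷ []) by (0 ∷ 0 ∷ 0 ∷ 0 ∷ 0 ∷ 1 ∷ 0 ∷ 0 ∷ 0 ∷ 0 ∷ 0 ∷ 0 ∷ 1 ∷ []) ∷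
  (P ∷ P ∷ P ∷ Z ∷ Z ∷ P ∷ []) by (0 ∷ 0 ∷ 0 ∷ 0 ∷ 0 ∷ 1 ∷ 0 ∷ 0 ∷ 0 ∷ 0 ∷ 0 ∷ 0 ∷ 1 ∷ []) ∷
  (P ∷ P ∷ P ∷ Z ∷ N ∷ Z ∷ []) by (2 ∷ 0 ∷ 0 ∷ 0 ∷ 0 ∷ 1 ∷ 0 ∷ 1 ∷ 0 ∷ 0 ∷ 0 ∷ 1 ∷ 0 ∷ []) ∷
  (Z ∷ P ∷ P ∷ P ∷ P ∷ Z ∷ []) by (0 ∷ 0 ∷ 0 ∷ 0 ∷ 0 ∷ 0 ∷ 1 ∷ 0 ∷ 0 ∷ 1 ∷ 1 ∷ 0 ∷ 1 ∷ []) ∷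
  (P ∷ P ∷ P ∷ N ∷ Z ∷ Z ∷ []) by (2 ∷ 0 ∷ 0 ∷ 0 ∷ 0 ∷ 1 ∷ 0 ∷ 1 ∷ 1 ∷ 0 ∷ 0 ∷ 1 ∷ 0 ∷ []) ∷
  (Z ∷ P ∷ P ∷ P ∷ Z ∷ P ∷ []) by (0 ∷ 0 ∷ 0 ∷ 0 ∷ 0 ∷ 0 ∷ 0 ∷ 0 ∷ 0 ∷ 0 ∷ 0 ∷ 0 ∷ 1 ∷ []) ∷
  (P ∷ Z ∷ P ∷ P ∷ N ∷ Z ∷ []) by (0 ∷ 0 ∷ 0 ∷ 0 ∷ 0 ∷ 1 ∷ 0 ∷ 0 ∷ 0 ∷ 0 ∷ 0 ∷ 0 ∷ 0 ∷ []) ∷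
  (Z ∷ P ∷ P ∷ P ∷ N ∷ Z ∷ []) by (0 ∷ 0 ∷ 0 ∷ 0 ∷ 0 ∷ 0 ∷ 0 ∷ 1 ∷ 0 ∷ 1 ∷ 1 ∷ 0 ∷ 1 ∷ []) ∷
  (P ∷ P ∷ N ∷ P ∷ Z ∷ Z ∷ []) by (2 ∷ 0 ∷ 0 ∷ 0 ∷ 0 ∷ 1 ∷ 0 ∷ 0 ∷ 0 ∷ 0 ∷ 0 ∷ 1 ∷ 0 ∷ []) ∷
  (Z ∷ P ∷ Z ∷ P ∷ P ∷ P ∷ []) by (0 ∷ 0 ∷ 0 ∷ 0 ∷ 0 ∷ 0 ∷ 0 ∷ 0 ∷ 0 ∷ 1 ∷ 1 ∷ 0 ∷ 1 ∷ []) ∷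
  (P ∷ P ∷ N ∷ Z ∷ P ∷ Z ∷ []) by (0 ∷ 0 ∷ 0 ∷ 0 ∷ 0 ∷ 1 ∷ 1 ∷ 0 ∷ 0 ∷ 0 ∷ 0 ∷ 1 ∷ 0 ∷ []) ∷
  (Z ∷ P ∷ P ∷ N ∷ P ∷ Z ∷ []) by (0 ∷ 0 ∷ 0 ∷ 0 ∷ 0 ∷ 0 ∷ 0 ∷ 1 ∷ 1 ∷ 0 ∷ 0 ∷ 1 ∷ 1 ∷ []) ∷
  (P ∷ N ∷ P ∷ P ∷ Z ∷ Z ∷ []) by (0 ∷ 0 ∷ 0 ∷ 0 ∷ 0 ∷ 1 ∷ 1 ∷ 0 ∷ 0 ∷ 1 ∷ 1 ∷ 0 ∷ 0 ∷ []) ∷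
  [ (Z ∷ P ∷ P ∷ N ∷ Z ∷ P ∷ []) by (0 ∷ 0 ∷ 0 ∷ 0 ∷ 0 ∷ 5 ∷ 0 ∷ 2 ∷ 0 ∷ 1 ∷ 0 ∷ 1 ∷ 5 ∷ []) ]

b₆>b₅+d : CertifiedChain
b₆>b₅+d =
  (P ∷ P ∷ P ∷ P ∷ Z ∷ Z ∷ []) by (0 ∷ 1 ∷ 0 ∷ 0 ∷ 0 ∷ 0 ∷ 0 ∷ 0 ∷ 0 ∷ 1 ∷ 0 ∷ 0 ∷ 0 ∷ []) ∷
  (P ∷ P ∷ P ∷ Z ∷ P ∷ Z ∷ []) by (0 ∷ 1 ∷ 0 ∷ 0 ∷ 0 ∷ 0 ∷ 0 ∷ 0 ∷ 0 ∷ 0 ∷ 0 ∷ 0 ∷ 0 ∷ []) ∷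
  (P ∷ P ∷ P ∷ Z ∷ Z ∷ P ∷ []) by (0 ∷ 1 ∷ 0 ∷ 0 ∷ 0 ∷ 0 ∷ 0 ∷ 0 ∷ 0 ∷ 0 ∷ 0 ∷ 0 ∷ 0 ∷ []) ∷
  (P ∷ P ∷ P ∷ Z ∷ N ∷ Z ∷ []) by (0 ∷ 1 ∷ 0 ∷ 0 ∷ 0 ∷ 0 ∷ 0 ∷ 0 ∷ 0 ∷ 1 ∷ 0 ∷ 0 ∷ 0 ∷ []) ∷
  (P ∷ P ∷ P ∷ N ∷ Z ∷ Z ∷ []) by (0 ∷ 1 ∷ 0 ∷ 0 ∷ 0 ∷ 0 ∷ 0 ∷ 1 ∷ 1 ∷ 0 ∷ 0 ∷ 1 ∷ 0 ∷ []) ∷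
  (P ∷ Z ∷ P ∷ P ∷ N ∷ Z ∷ []) by (0 ∷ 1 ∷ 0 ∷ 0 ∷ 0 ∷ 0 ∷ 0 ∷ 1 ∷ 0 ∷ 1 ∷ 1 ∷ 0 ∷ 0 ∷ []) ∷
  (P ∷ P ∷ N ∷ P ∷ Z ∷ Z ∷ []) by (0 ∷ 1 ∷ 0 ∷ 0 ∷ 0 ∷ 0 ∷ 0 ∷ 0 ∷ 0 ∷ 1 ∷ 0 ∷ 0 ∷ 0 ∷ []) ∷
  (P ∷ P ∷ N ∷ Z ∷ P ∷ Z ∷ []) by (0 ∷ 1 ∷ 0 ∷ 0 ∷ 0 ∷ 0 ∷ 0 ∷ 0 ∷ 1 ∷ 0 ∷ 0 ∷ 2 ∷ 0 ∷ []) ∷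
  (P ∷ N ∷ P ∷ P ∷ Z ∷ Z ∷ []) by (0 ∷ 1 ∷ 0 ∷ 0 ∷ 0 ∷ 0 ∷ 0 ∷ 0 ∷ 0 ∷ 1 ∷ 2 ∷ 0 ∷ 0 ∷ []) ∷
  (P ∷ P ∷ N ∷ Z ∷ N ∷ Z ∷ []) by (0 ∷ 1 ∷ 0 ∷ 0 ∷ 0 ∷ 0 ∷ 0 ∷ 0 ∷ 0 ∷ 1 ∷ 0 ∷ 0 ∷ 0 ∷ []) ∷
  (P ∷ P ∷ N ∷ N ∷ Z ∷ Z ∷ []) by (0 ∷ 1 ∷ 0 ∷ 0 ∷ 0 ∷ 0 ∷ 0 ∷ 0 ∷ 1 ∷ 0 ∷ 0 ∷ 2 ∷ 0 ∷ []) ∷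
  (P ∷ N ∷ P ∷ Z ∷ N ∷ Z ∷ []) by (0 ∷ 1 ∷ 0 ∷ 0 ∷ 0 ∷ 0 ∷ 0 ∷ 0 ∷ 0 ∷ 1 ∷ 0 ∷ 0 ∷ 0 ∷ []) ∷
  (P ∷ N ∷ P ∷ N ∷ Z ∷ Z ∷ []) by (0 ∷ 1 ∷ 0 ∷ 0 ∷ 0 ∷ 0 ∷ 0 ∷ 1 ∷ 0 ∷ 1 ∷ 1 ∷ 0 ∷ 0 ∷ []) ∷
  (P ∷ Z ∷ N ∷ N ∷ P ∷ Z ∷ []) by (0 ∷ 1 ∷ 0 ∷ 0 ∷ 0 ∷ 0 ∷ 0 ∷ 1 ∷ 1 ∷ 0 ∷ 0 ∷ 1 ∷ 0 ∷ []) ∷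
  [ (P ∷ N ∷ N ∷ P ∷ Z ∷ Z ∷ []) by (0 ∷ 0 ∷ 0 ∷ 0 ∷ 0 ∷ 0 ∷ 1 ∷ 0 ∷ 0 ∷ 0 ∷ 0 ∷ 0 ∷ 1 ∷ []) ]

b₅>b₄+d : CertifiedChain
b₅>b₄+d =
  (P ∷ P ∷ P ∷ P ∷ Z ∷ Z ∷ []) by (0 ∷ 1 ∷ 0 ∷ 0 ∷ 0 ∷ 0 ∷ 0 ∷ 0 ∷ 0 ∷ 1 ∷ 0 ∷ []) ∷
  (P ∷ P ∷ P ∷ Z ∷ P ∷ Z ∷ []) by (0 ∷ 1 ∷ 0 ∷ 0 ∷ 0 ∷ 0 ∷ 0 ∷ 0 ∷ 0 ∷ 0 ∷ 0 ∷ []) ∷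
  (P ∷ P ∷ P ∷ Z ∷ Z ∷ P ∷ []) by (0 ∷ 1 ∷ 0 ∷ 0 ∷ 0 ∷ 0 ∷ 0 ∷ 0 ∷ 0 ∷ 0 ∷ 0 ∷ []) ∷
  (P ∷ P ∷ P ∷ Z ∷ N ∷ Z ∷ []) by (0 ∷ 1 ∷ 0 ∷ 0 ∷ 0 ∷ 0 ∷ 0 ∷ 0 ∷ 0 ∷ 1 ∷ 0 ∷ []) ∷
  (P ∷ P ∷ P ∷ N ∷ Z ∷ Z ∷ []) by (2 ∷ 0 ∷ 0 ∷ 0 ∷ 0 ∷ 0 ∷ 0 ∷ 1 ∷ 1 ∷ 0 ∷ 1 ∷ []) ∷
  (P ∷ Z ∷ P ∷ P ∷ Z ∷ P ∷ []) by (0 ∷ 1 ∷ 0 ∷ 0 ∷ 0 ∷ 0 ∷ 0 ∷ 0 ∷ 0 ∷ 0 ∷ 0 ∷ []) ∷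
  (P ∷ Z ∷ P ∷ P ∷ N ∷ Z ∷ []) by (2 ∷ 1 ∷ 0 ∷ 0 ∷ 0 ∷ 0 ∷ 0 ∷ 1 ∷ 0 ∷ 1 ∷ 0 ∷ []) ∷
  (P ∷ Z ∷ Z ∷ P ∷ P ∷ P ∷ []) by (0 ∷ 1 ∷ 0 ∷ 0 ∷ 0 ∷ 0 ∷ 1 ∷ 0 ∷ 0 ∷ 1 ∷ 0 ∷ []) ∷
  (P ∷ Z ∷ P ∷ N ∷ P ∷ Z ∷ []) by (0 ∷ 1 ∷ 0 ∷ 0 ∷ 0 ∷ 0 ∷ 0 ∷ 0 ∷ 0 ∷ 0 ∷ 0 ∷ []) ∷
  (P ∷ Z ∷ P ∷ N ∷ Z ∷ P ∷ []) by (0 ∷ 1 ∷ 0 ∷ 0 ∷ 0 ∷ 0 ∷ 0 ∷ 0 ∷ 0 ∷ 0 ∷ 0 ∷ []) ∷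
  (P ∷ Z ∷ P ∷ N ∷ N ∷ Z ∷ []) by (2 ∷ 1 ∷ 0 ∷ 0 ∷ 0 ∷ 0 ∷ 0 ∷ 2 ∷ 0 ∷ 0 ∷ 0 ∷ []) ∷
  (P ∷ Z ∷ N ∷ P ∷ Z ∷ P ∷ []) by (0 ∷ 1 ∷ 0 ∷ 0 ∷ 0 ∷ 0 ∷ 0 ∷ 0 ∷ 0 ∷ 0 ∷ 0 ∷ []) ∷
  (P ∷ Z ∷ N ∷ P ∷ N ∷ Z ∷ []) by (0 ∷ 1 ∷ 0 ∷ 0 ∷ 0 ∷ 0 ∷ 1 ∷ 0 ∷ 0 ∷ 1 ∷ 0 ∷ []) ∷
  (P ∷ Z ∷ Z ∷ N ∷ N ∷ P ∷ []) by (0 ∷ 1 ∷ 0 ∷ 0 ∷ 0 ∷ 0 ∷ 0 ∷ 1 ∷ 0 ∷ 1 ∷ 0 ∷ []) ∷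
  [ (P ∷ Z ∷ N ∷ N ∷ P ∷ Z ∷ []) by (0 ∷ 0 ∷ 0 ∷ 0 ∷ 0 ∷ 1 ∷ 0 ∷ 0 ∷ 1 ∷ 0 ∷ 1 ∷ []) ]

b₃>2d : CertifiedChain
b₃>2d =
  (P ∷ P ∷ P ∷ P ∷ Z ∷ Z ∷ []) by (0 ∷ 1 ∷ 0 ∷ 0 ∷ 0 ∷ 0 ∷ 0 ∷ 0 ∷ 1 ∷ []) ∷
  (P ∷ P ∷ P ∷ Z ∷ P ∷ Z ∷ []) by (0 ∷ 1 ∷ 0 ∷ 0 ∷ 0 ∷ 0 ∷ 0 ∷ 0 ∷ 0 ∷ []) ∷
  (P ∷ P ∷ P ∷ Z ∷ Z ∷ P ∷ []) by (0 ∷ 1 ∷ 0 ∷ 0 ∷ 0 ∷ 0 ∷ 0 ∷ 0 ∷ 0 ∷ []) ∷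
  (P ∷ P ∷ P ∷ Z ∷ N ∷ Z ∷ []) by (0 ∷ 1 ∷ 0 ∷ 0 ∷ 0 ∷ 0 ∷ 0 ∷ 1 ∷ 0 ∷ []) ∷
  (P ∷ P ∷ Z ∷ P ∷ N ∷ Z ∷ []) by (0 ∷ 0 ∷ 0 ∷ 0 ∷ 0 ∷ 0 ∷ 1 ∷ 0 ∷ 1 ∷ []) ∷
  (P ∷ P ∷ P ∷ N ∷ Z ∷ Z ∷ []) by (2 ∷ 0 ∷ 0 ∷ 0 ∷ 1 ∷ 0 ∷ 0 ∷ 1 ∷ 0 ∷ []) ∷
  (P ∷ Z ∷ P ∷ Z ∷ P ∷ P ∷ []) by (0 ∷ 1 ∷ 0 ∷ 0 ∷ 0 ∷ 0 ∷ 0 ∷ 1 ∷ 0 ∷ []) ∷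
  (P ∷ Z ∷ Z ∷ P ∷ P ∷ P ∷ []) by (0 ∷ 1 ∷ 0 ∷ 0 ∷ 0 ∷ 0 ∷ 1 ∷ 0 ∷ 0 ∷ []) ∷
  (P ∷ Z ∷ P ∷ Z ∷ N ∷ P ∷ []) by (0 ∷ 0 ∷ 0 ∷ 0 ∷ 0 ∷ 0 ∷ 0 ∷ 0 ∷ 1 ∷ []) ∷
  (P ∷ Z ∷ P ∷ N ∷ P ∷ Z ∷ []) by (0 ∷ 1 ∷ 0 ∷ 0 ∷ 0 ∷ 0 ∷ 0 ∷ 0 ∷ 0 ∷ []) ∷
  (P ∷ Z ∷ P ∷ N ∷ Z ∷ P ∷ []) by (0 ∷ 1 ∷ 0 ∷ 0 ∷ 0 ∷ 0 ∷ 0 ∷ 0 ∷ 0 ∷ []) ∷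
  (P ∷ Z ∷ P ∷ N ∷ N ∷ Z ∷ []) by (2 ∷ 1 ∷ 0 ∷ 0 ∷ 0 ∷ 0 ∷ 0 ∷ 2 ∷ 0 ∷ []) ∷
  (P ∷ Z ∷ N ∷ P ∷ Z ∷ P ∷ []) by (0 ∷ 1 ∷ 0 ∷ 0 ∷ 0 ∷ 0 ∷ 0 ∷ 0 ∷ 0 ∷ []) ∷
  (P ∷ Z ∷ N ∷ P ∷ N ∷ Z ∷ []) by (2 ∷ 0 ∷ 0 ∷ 0 ∷ 0 ∷ 0 ∷ 0 ∷ 0 ∷ 1 ∷ []) ∷
  [ (P ∷ Z ∷ N ∷ Z ∷ P ∷ P ∷ []) by (0 ∷ 1 ∷ 0 ∷ 0 ∷ 1 ∷ 1 ∷ 0 ∷ 0 ∷ 0 ∷ []) ]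

b₄>b₃+d : CertifiedChain
b₄>b₃+d =
  (P ∷ P ∷ P ∷ P ∷ Z ∷ Z ∷ []) by (0 ∷ 0 ∷ 1 ∷ 0 ∷ 0 ∷ 0 ∷ 0 ∷ []) ∷
  (P ∷ P ∷ P ∷ Z ∷ P ∷ Z ∷ []) by (0 ∷ 1 ∷ 0 ∷ 0 ∷ 0 ∷ 0 ∷ 0 ∷ []) ∷
  (P ∷ P ∷ P ∷ Z ∷ Z ∷ P ∷ []) by (0 ∷ 1 ∷ 0 ∷ 0 ∷ 0 ∷ 0 ∷ 0 ∷ []) ∷
  (P ∷ P ∷ P ∷ Z ∷ N ∷ Z ∷ []) by (0 ∷ 0 ∷ 1 ∷ 0 ∷ 0 ∷ 0 ∷ 0 ∷ []) ∷
  (P ∷ P ∷ P ∷ N ∷ Z ∷ Z ∷ []) by (2 ∷ 0 ∷ 0 ∷ 0 ∷ 0 ∷ 0 ∷ 1 ∷ []) ∷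
  (P ∷ P ∷ Z ∷ Z ∷ P ∷ P ∷ []) by (0 ∷ 1 ∷ 1 ∷ 0 ∷ 0 ∷ 0 ∷ 0 ∷ []) ∷
  (P ∷ P ∷ Z ∷ N ∷ P ∷ Z ∷ []) by (0 ∷ 1 ∷ 0 ∷ 0 ∷ 0 ∷ 0 ∷ 0 ∷ []) ∷
  (P ∷ P ∷ Z ∷ N ∷ Z ∷ P ∷ []) by (0 ∷ 0 ∷ 0 ∷ 0 ∷ 0 ∷ 0 ∷ 1 ∷ []) ∷
  (P ∷ P ∷ N ∷ Z ∷ P ∷ Z ∷ []) by (0 ∷ 1 ∷ 0 ∷ 0 ∷ 0 ∷ 0 ∷ 0 ∷ []) ∷
  (P ∷ P ∷ N ∷ Z ∷ Z ∷ P ∷ []) by (0 ∷ 1 ∷ 0 ∷ 0 ∷ 0 ∷ 0 ∷ 0 ∷ []) ∷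
  (P ∷ P ∷ N ∷ Z ∷ N ∷ Z ∷ []) by (0 ∷ 0 ∷ 1 ∷ 0 ∷ 0 ∷ 0 ∷ 0 ∷ []) ∷
  (P ∷ P ∷ N ∷ N ∷ Z ∷ Z ∷ []) by (0 ∷ 1 ∷ 0 ∷ 0 ∷ 1 ∷ 0 ∷ 0 ∷ []) ∷
  (P ∷ Z ∷ Z ∷ N ∷ N ∷ P ∷ []) by (0 ∷ 0 ∷ 0 ∷ 0 ∷ 0 ∷ 1 ∷ 0 ∷ []) ∷
  (Z ∷ P ∷ Z ∷ N ∷ N ∷ P ∷ []) by (0 ∷ 0 ∷ 0 ∷ 0 ∷ 1 ∷ 0 ∷ 0 ∷ []) ∷
  [ (Z ∷ Z ∷ P ∷ N ∷ N ∷ P ∷ []) by (0 ∷ 0 ∷ 0 ∷ 0 ∷ 0 ∷ 0 ∷ 1 ∷ []) ]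

nonAP⇒FourSumChain₆ : ∀ {b₆ b₅ b₄ b₃ d} → 0 < d → d < b₃ → b₃ < b₄ → b₄ < b₅ → b₅ < b₆ →
  b₆ ∷ b₅ ∷ b₄ ∷ b₃ ∷ d ∷ 0 ∷ [] ≢ apList d 6 → FourSumChain 15 (b₆ ∷ b₅ ∷ b₄ ∷ b₃ ∷ d ∷ 0 ∷ [])
nonAP⇒FourSumChain₆ {b₆} {b₅} {b₄} {b₃} {d} 0<d d<b₃ b₃<b₄ b₄<b₅ b₅<b₆ notAP =
  compare b₄+z b₃+d
    (λ h → certified (ordering ++ [ fact b₄+z b₃+d true h ]) b₄<b₃+d ≡.refl)
    (λ e₃ → compare b₃+z 2d
      (λ h → certified (ordering ++ ≡-facts b₄+z b₃+d e₃ ++ [ fact b₃+z 2d true h ]) b₃<2d ≡.refl)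
      (λ e₂ → compare b₅+z b₄+d
        (λ h → certified (ordering ++ ≡-facts b₄+z b₃+d e₃ ++ ≡-facts b₃+z 2d e₂ ++
                          [ fact b₅+z b₄+d true h ]) b₅<b₄+d ≡.refl)
        (λ e₄ → compare b₆+z b₅+d
          (λ h → certified (ordering ++ ≡-facts b₄+z b₃+d e₃ ++ ≡-facts b₃+z 2d e₂ ++
                            ≡-facts b₅+z b₄+d e₄ ++ [ fact b₆+z b₅+d true h ]) b₆<b₅+d ≡.refl)
          (λ e₅ → ⊥-elim (notAP (gaps⇒apList (≡.trans (sym (unit b₃)) (≡.trans e₂ (ℕP.+-identityʳ (2 * d))))
                                             (gap b₄ b₃ e₃) (gap b₅ b₄ e₄) (gap b₆ b₅ e₅))))
          (λ h → certified (ordering ++ ≡-facts b₄+z b₃+d e₃ ++ ≡-facts b₃+z 2d e₂ ++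
                            ≡-facts b₅+z b₄+d e₄ ++ [ fact b₅+d b₆+z true h ]) b₆>b₅+d ≡.refl))
        (λ h → certified (ordering ++ ≡-facts b₄+z b₃+d e₃ ++ ≡-facts b₃+z 2d e₂ ++
                          [ fact b₄+d b₅+z true h ]) b₅>b₄+d ≡.refl))
      (λ h → certified (ordering ++ ≡-facts b₄+z b₃+d e₃ ++ [ fact 2d b₃+z true h ]) b₃>2d ≡.refl))
    (λ h → certified (ordering ++ [ fact b₃+d b₄+z true h ]) b₄>b₃+d ≡.refl)
  where
  X = b₆ ∷ b₅ ∷ b₄ ∷ b₃ ∷ d ∷ 0 ∷ []
  𝟎 ‵b₆ ‵b₅ ‵b₄ ‵b₃ ‵d ‵z : List ℕ
  𝟎   = 0 ∷ 0 ∷ 0 ∷ 0 ∷ 0 ∷ 0 ∷ []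
  ‵b₆ = 1 ∷ 0 ∷ 0 ∷ 0 ∷ 0 ∷ 0 ∷ []
  ‵b₅ = 0 ∷ 1 ∷ 0 ∷ 0 ∷ 0 ∷ 0 ∷ []
  ‵b₄ = 0 ∷ 0 ∷ 1 ∷ 0 ∷ 0 ∷ 0 ∷ []
  ‵b₃ = 0 ∷ 0 ∷ 0 ∷ 1 ∷ 0 ∷ 0 ∷ []
  ‵d  = 0 ∷ 0 ∷ 0 ∷ 0 ∷ 1 ∷ 0 ∷ []
  ‵z  = 0 ∷ 0 ∷ 0 ∷ 0 ∷ 0 ∷ 1 ∷ []

  -- Comparing b_{i+1} + 0 with b_i + d (where b₂ = d) decides whether the i-th gap equals d.
  b₆+z b₅+z b₄+z b₃+z b₅+d b₄+d b₃+d 2d : List ℕ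
  b₆+z = ‵b₆ ⊕ ‵z
  b₅+z = ‵b₅ ⊕ ‵z
  b₄+z = ‵b₄ ⊕ ‵z
  b₃+z = ‵b₃ ⊕ ‵z
  b₅+d = ‵b₅ ⊕ ‵d
  b₄+d = ‵b₄ ⊕ ‵d
  b₃+d = ‵b₃ ⊕ ‵d
  2d   = ‵d ⊕ ‵d

  unit : ∀ x → x + 0 + 0 ≡ x
  unit x = ≡.trans (ℕP.+-identityʳ (x + 0)) (ℕP.+-identityʳ x)
  pair : ∀ x y → x + 0 + (y + 0 + 0) ≡ y + x
  pair = solve-∀
  gap : ∀ x y → x + 0 + 0 ≡ y + 0 + (d + 0 + 0) → x ≡ d + y
  gap x y e = ≡.trans (sym (unit x)) (≡.trans e (pair y d))

  ordering : List (LinearFact X)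
  ordering = fact ‵z 𝟎 false z≤n
           ∷ fact ‵z ‵d true (subst (0 <_) (sym (unit d)) 0<d)
           ∷ fact ‵d ‵b₃ true (subst₂ _<_ (sym (unit d)) (sym (unit b₃)) d<b₃)
           ∷ fact ‵b₃ ‵b₄ true (subst₂ _<_ (sym (unit b₃)) (sym (unit b₄)) b₃<b₄)
           ∷ fact ‵b₄ ‵b₅ true (subst₂ _<_ (sym (unit b₄)) (sym (unit b₅)) b₄<b₅)
           ∷ fact ‵b₅ ‵b₆ true (subst₂ _<_ (sym (unit b₅)) (sym (unit b₆)) b₅<b₆)
           ∷ []

  ≡-facts : ∀ u v → u · X ≡ v · X → List (LinearFact X)
  ≡-facts u v e = fact u v false (ℕP.≤-reflexive e) ∷ fact v u false (ℕP.≤-reflexive (sym e)) ∷ []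

  compare : ∀ {R : Set} u v → (u · X < v · X → R) → (u · X ≡ v · X → R) → (v · X < u · X → R) → R
  compare u v lt eq gt with ℕP.<-cmp (u · X) (v · X)
  ... | tri< h _ _ = lt h
  ... | tri≈ _ h _ = eq h
  ... | tri> _ _ h = gt h

  certified : ∀ F c → {T (Valid 4 X F c)} → value (head c) X ≡ value top X → FourSumChain (chainLength c) X
  certified F c {valid} = Valid⇒FourSumChain X F c valid

-- Induction on k and the theorem

nonAP⇒FourSumChain : ∀ {d} n {D} → Decreasing d (6 + n) D → D ≢ apList d (6 + n) → FourSumChain (15 + n * 4) D
nonAP⇒FourSumChain zero (b₅<b₆ ∷ b₄<b₅ ∷ b₃<b₄ ∷ d<b₃ ∷ [ 0<d ,0]) notAP = nonAP⇒FourSumChain₆ 0<d d<b₃ b₃<b₄ b₄<b₅ b₅<b₆ notAP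
nonAP⇒FourSumChain zero (_ ∷ _ ∷ _ ∷ _ ∷ _ ∷ _ ∷ ()) _
nonAP⇒FourSumChain {d} (suc n) (_∷_ {x = x} {y₁} {D} y₁<x dec@(y₂<y₁ ∷ y₃<y₂ ∷ y₄<y₃ ∷ _)) notAP
  with ≡-dec ℕP._≟_ (y₁ ∷ D) (apList d (6 + n))
... | yes tail≡AP = subst (λ tail → FourSumChain (19 + n * 4) (x ∷ tail)) (sym tail≡AP)
      (AP-extension (Decreasing-pos dec) (subst (_< x) (∷-injectiveˡ tail≡AP) y₁<x) (λ x≡ → notAP (cong₂ _∷_ x≡ tail≡AP)))
... | no  tail≢AP = FourSumChain-∷ y₂<y₁ y₃<y₂ y₄<y₃ y₁<x (nonAP⇒FourSumChain n dec tail≢AP)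

module _ {A : Set} where

  descending : ∀ {k} → (Fin k → A) → List A
  descending {zero}  a = []
  descending {suc k} a = a (fromℕ k) ∷ descending (a ∘ inject₁)

  toList-∷ʳ : ∀ {k} (a : Fin (suc k) → A) → toList a ≡ toList (a ∘ inject₁) ∷ʳ a (fromℕ k)
  toList-∷ʳ {zero}  a = ≡.refl
  toList-∷ʳ {suc k} a = cong (a Fin.zero ∷_) (toList-∷ʳ (a ∘ Fin.suc))

  descending-↭ : ∀ {k} (a : Fin k → A) → descending a ↭ toList a
  descending-↭ {zero}  a = refl
  descending-↭ {suc k} a = trans (prep _ (descending-↭ (a ∘ inject₁)))
    (trans (∷↭∷ʳ (a (fromℕ k)) (toList (a ∘ inject₁))) (↭-reflexive (sym (toList-∷ʳ a))))

  descending-applyDownFrom : ∀ {k} (a : Fin k → A) f → descending a ≡ applyDownFrom f k → ∀ i → a i ≡ f (toℕ i)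
  descending-applyDownFrom {suc k} a f eq i with toℕ i ℕP.≟ k
  ... | yes i≡k = ≡.trans (cong a (FinP.toℕ-injective (≡.trans i≡k (sym (FinP.toℕ-fromℕ k)))))
                          (≡.trans (∷-injectiveˡ eq) (cong f (sym i≡k)))
  ... | no  i≢k = ≡.trans (cong a (sym (FinP.inject₁-lower₁ i k≢i)))
        (≡.trans (descending-applyDownFrom (a ∘ inject₁) f (∷-injectiveʳ eq) j)
                 (cong f (≡.trans (sym (FinP.toℕ-inject₁ j)) (cong toℕ (FinP.inject₁-lower₁ i k≢i)))))
    where
    k≢i : k ≢ toℕ i
    k≢i = i≢k ∘ sym
    j : Fin k
    j = lower₁ i k≢i

descending-Decreasing : ∀ m (a : Fin (2 + m) → ℕ) → (∀ i j → toℕ i < toℕ j → a i < a j) → a Fin.zero ≡ 0 →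
                        Decreasing (a (Fin.suc Fin.zero)) (2 + m) (descending a)
descending-Decreasing zero a mono a₀≡0 =
  subst (λ t → Decreasing (a (Fin.suc Fin.zero)) 2 (a (Fin.suc Fin.zero) ∷ t ∷ [])) (sym a₀≡0)
    [ subst (_< a (Fin.suc Fin.zero)) a₀≡0 (mono Fin.zero (Fin.suc Fin.zero) (s≤s z≤n)) ,0]
descending-Decreasing (suc m) a mono a₀≡0 =
  mono _ _ (subst₂ _<_ (sym (≡.trans (FinP.toℕ-inject₁ (fromℕ (suc m))) (FinP.toℕ-fromℕ (suc m))))
                        (sym (FinP.toℕ-fromℕ (2 + m))) ℕP.≤-refl)
  ∷ descending-Decreasing m (a ∘ inject₁)
      (λ i j i<j → mono _ _ (subst₂ _<_ (sym (FinP.toℕ-inject₁ i)) (sym (FinP.toℕ-inject₁ j)) i<j)) a₀≡0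

FourSumChain⇒card : ∀ {ℓ k} (a : Fin k → ℕ) → FourSumChain ℓ (descending a) →
                    ℓ + ℓ ≤ card-hSignedSumset 4 (λ i → + (a i))
FourSumChain⇒card a (chain c long descends) =
  ℕP.≤-trans (ℕP.+-mono-≤ long long)
    (DescendingChain⇒card (DescendingChain-map (subst (λ xs → SignedSum 4 xs _) (map-tabulate a (+_)) ∘ SignedSum-resp-↭ perm)
                                               (descends ℕP.≤-refl)))
  where
  perm : map +_ (descending a) ↭ map +_ (toList a)
  perm = ↭-map⁺ +_ (descending-↭ a)

image-of-AP : ∀ {k} (a : Fin (suc k) → ℕ) d → (∀ i → a i ≡ toℕ i * d) →
              ∀ n → (∃ λ i → a i ≡ n) ⇔ (∃ λ j → (j ≤ k) × (n ≡ d * j))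
image-of-AP a d a≡ n = mk⇔
  (λ (i , aᵢ≡n) → toℕ i , ℕP.≤-pred (FinP.toℕ<n i) , ≡.trans (sym aᵢ≡n) (≡.trans (a≡ i) (ℕP.*-comm (toℕ i) d)))
  (λ (j , j≤k , n≡) → Fin.fromℕ< (s≤s j≤k) ,
     ≡.trans (a≡ _) (≡.trans (cong (_* d) (FinP.toℕ-fromℕ< (s≤s j≤k))) (≡.trans (ℕP.*-comm j d) (sym n≡))))

too-many-sums : ∀ m → 8 * (6 + m) ∸ 19 < (15 + m * 4) + (15 + m * 4)
too-many-sums m = subst₂ _<_ (sym (≡.trans (cong (_∸ 19) (eq₁ m)) (ℕP.m+n∸m≡n 19 (29 + m * 8)))) (eq₂ m) ℕP.≤-refl
  where
  eq₁ : ∀ m → 8 * (6 + m) ≡ 19 + (29 + m * 8)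
  eq₁ = solve-∀
  eq₂ : ∀ m → 30 + m * 8 ≡ (15 + m * 4) + (15 + m * 4)
  eq₂ = solve-∀

lemma3p1 : (k : ℕ) → 6 ≤ k →
    (a : Fin k → ℕ) →
    (∀ (i j : Fin k) → toℕ i < toℕ j → a i < a j) →
    (∀ (i : Fin k) → toℕ i ≡ 0 → a i ≡ 0) →
    card-hSignedSumset 4 (λ i → + (a i)) ≡ 8 * k ∸ 19 →
    (a₂ : ℕ) → (∀ (i : Fin k) → toℕ i ≡ 1 → a i ≡ a₂) →
    ∀ (n : ℕ) → (∃ λ (i : Fin k) → a i ≡ n) ⇔ (∃ λ (j : ℕ) → (j ≤ k ∸ 1) × (n ≡ a₂ * j))
lemma3p1 (suc (suc (suc (suc (suc (suc m)))))) (s≤s (s≤s (s≤s (s≤s (s≤s (s≤s z≤n)))))) a mono a₀≡0 card a₂ a₁≡a₂ n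
  with ≡-dec ℕP._≟_ (descending a) (apList (a (Fin.suc Fin.zero)) (6 + m))
... | no  notAP = ⊥-elim (ℕP.<⇒≱ (too-many-sums m) (subst (_ ≤_) card (FourSumChain⇒card a many)))
  where many = nonAP⇒FourSumChain m (descending-Decreasing (4 + m) a mono (a₀≡0 Fin.zero ≡.refl)) notAP
... | yes isAP  = image-of-AP a a₂ a≡ n
  where
  a≡ : ∀ i → a i ≡ toℕ i * a₂
  a≡ i = ≡.trans (descending-applyDownFrom a (_* a (Fin.suc Fin.zero)) isAP i) (cong (toℕ i *_) (a₁≡a₂ (Fin.suc Fin.zero) ≡.refl))
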